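{- Fix an integer $r\ge3$. Any $C_r$-free graph on $n$ vertices with minimum degree $d$ has fractional chromatic number at most $(r-2)n/d$, and thus contains a bipartite induced subgraph of minimum degree at least $d^2/(2(r-2)n)$.
   Context: $C_r$ is the cycle on $r$ vertices; a graph is $C_r$-free if it contains no subgraph isomorphic to $C_r$. A bipartite induced subgraph is a subgraph induced by a nonempty vertex set which is bipartite. -}

module Defs where

open import Data.Nat using (ℕ; zero; suc; _∸_)
open import Data.Bool using (Bool; true; false; _∧_)
open import Data.Fin using (Fin; toℕ)
open import Data.Product using (Σ; ∃; _×_; _,_)
open import Data.Sum using (_⊎_)
open import Data.Rational using (ℚ; 0ℚ; 1ℚ; _+_; _≤_)
open import Relation.Binary.PropositionalEquality using (_≡_; _≢_)
open import Function.Definitions using (Injective)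

record Graph (n : ℕ) : Set where
  field
    adj   : Fin n → Fin n → Bool
    sym   : ∀ u v → adj u v ≡ adj v u
    irrefl : ∀ v → adj v v ≡ false

open Graph public

count : {k : ℕ} → (Fin k → Bool) → ℕ
count {zero} p = 0
count {suc k} p with p Data.Fin.zero
... | true  = suc (count (λ i → p (Data.Fin.suc i)))
... | false = count (λ i → p (Data.Fin.suc i))

degree : {n : ℕ} → Graph n → Fin n → ℕ
degree G v = count (adj G v)

MinDegree : {n : ℕ} → Graph n → ℕ → Set
MinDegree G d = (∀ v → d Data.Nat.≤ degree G v) × (∃ λ v → degree G v ≡ d)

CycleNext : {r : ℕ} → Fin r → Fin r → Set
CycleNext {r} i j = (toℕ j ≡ suc (toℕ i)) ⊎ ((toℕ i ≡ r ∸ 1) × (toℕ j ≡ 0))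

-- G contains C_r as a (not necessarily induced) subgraph
ContainsCycle : {n : ℕ} → ℕ → Graph n → Set
ContainsCycle {n} r G =
  Σ (Fin r → Fin n) λ f →
    Injective _≡_ _≡_ f × (∀ i j → CycleNext i j → adj G (f i) (f j) ≡ true)

VSet : ℕ → Set
VSet n = Fin n → Bool

Independent : {n : ℕ} → Graph n → VSet n → Set
Independent G S = ∀ u v → S u ≡ true → S v ≡ true → adj G u v ≡ false

∑ : {k : ℕ} → (Fin k → ℚ) → ℚ
∑ {zero} w = 0ℚ
∑ {suc k} w = w Data.Fin.zero + ∑ (λ i → w (Data.Fin.suc i))

∑[_] : {k : ℕ} → (Fin k → Bool) → (Fin k → ℚ) → ℚ
∑[_] {zero} b w = 0ℚ
∑[_] {suc k} b w with b Data.Fin.zero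
... | true  = w Data.Fin.zero + ∑[ (λ i → b (Data.Fin.suc i)) ] (λ i → w (Data.Fin.suc i))
... | false = ∑[ (λ i → b (Data.Fin.suc i)) ] (λ i → w (Data.Fin.suc i))

record FractionalColouring {n : ℕ} (G : Graph n) : Set where
  field
    k       : ℕ
    sets    : Fin k → VSet n
    weight  : Fin k → ℚ
    indep   : ∀ i → Independent G (sets i)
    nonneg  : ∀ i → 0ℚ ≤ weight i
    covers  : ∀ v → 1ℚ ≤ ∑[ (λ i → sets i v) ] weight

  total : ℚ
  total = ∑ weight

-- χ_f(G) ≤ q  (the LP minimum is attained, so this is the standard meaning)
FracChromaticAtMost : {n : ℕ} → Graph n → ℚ → Set
FracChromaticAtMost G q = Σ (FractionalColouring G) λ c → FractionalColouring.total c ≤ q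

BipartiteInduced : {n : ℕ} → Graph n → VSet n → Set
BipartiteInduced G S =
  Σ (VSet _) λ c → ∀ u v → S u ≡ true → S v ≡ true → adj G u v ≡ true → c u ≢ c v

degreeIn : {n : ℕ} → Graph n → VSet n → Fin n → ℕ
degreeIn G S v = count (λ u → adj G v u ∧ S u)

-- For a vertex v, put a neighbour u of v into layer t when some path u = u₀, u₁, …, u_t inside N(v) has
-- decreasing vertex indices, but no such path with t + 1 edges does.  Adjacent vertices of one layer are
-- impossible (the higher one prefixed to the path of the lower is one edge longer), and a path with r − 2
-- edges closes a C_r through v; so the r − 2 layers of all n vertices are K = (r − 2)n independent sets in which
-- every vertex u occurs at least deg u ≥ d times, and weight 1/d on each is a fractional colouring.
-- With m(x) ≥ d the number of these sets containing x, summing over all ordered pairs of sets gives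
--   Σ_{i,j} d² (|I_i| + |I_j|) = 2K d² Σ_x m(x) ≤ 2K Σ_{x∼y} m(x) m(y) = Σ_{i,j} 2K e(I_i, I_j),
-- so some pair spans a bipartite G[I_i ∪ I_j] of average degree at least d²/K.  Deleting vertices of
-- degree below d²/2K keeps the average degree above d²/K, so it ends at a nonempty bipartite induced
-- subgraph of minimum degree at least d²/2K.

module Submission where

open import Defs hiding (sym)
open import Data.Bool using (Bool; true; false; _∧_; _∨_; not)
import Data.Bool.Properties as Boolₚ
open import Data.Empty using (⊥; ⊥-elim)
open import Data.Fin using (Fin; zero; suc; toℕ; combine; remQuot; fromℕ<; _↑ˡ_; _↑ʳ_)
open import Data.Fin.Properties as Finₚ using (any?)
open import Data.Integer as ℤ using (+_)
import Data.Integer.Properties as ℤₚ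
import Data.Integer.Tactic.RingSolver as ℤ-Solver
open import Data.Nat hiding (_/_)
open import Data.Nat.Properties hiding (_≟_)
open import Data.Nat.Tactic.RingSolver using (solve-∀)
open import Data.Product using (Σ; ∃; ∃₂; _×_; _,_; proj₁; proj₂)
import Data.Product as Product
open import Data.Rational as ℚ using (ℚ; 0ℚ; 1ℚ; _/_; toℚᵘ)
import Data.Rational.Properties as ℚₚ
open import Data.Rational.Unnormalised as ℚᵘ using (mkℚᵘ; *≡*; *≤*; _≃_)
import Data.Rational.Unnormalised.Properties as ℚᵘₚ
open import Data.Sum using (inj₁; inj₂)
open import Function using (_∘_; id)
open import Relation.Binary using (tri<; tri≈; tri>)
open import Relation.Binary.PropositionalEquality
open import Relation.Nullary using (Dec; yes; no; does; ¬_; ¬?; contradiction)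
open import Relation.Nullary.Decidable using (_×-dec_; dec-true)
open import Relation.Unary using (Decidable)
open import Algebra.Properties.CommutativeSemigroup *-commutativeSemigroup using (x∙yz≈y∙xz; x∙yz≈z∙yx)
open import Algebra.Properties.Semiring.Sum +-*-semiring
  using (sum; sum-cong-≗; ∑-distrib-+; ∑-comm; *-distribˡ-sum; *-distribʳ-sum; sum-replicate-zero)

-- Finite sums of natural numbers

χ : Bool → ℕ
χ true  = 1
χ false = 0

χ-∧ : ∀ a b → χ (a ∧ b) ≡ χ a * χ b
χ-∧ true  b = sym (+-identityʳ (χ b))
χ-∧ false b = refl

χ-∨ : ∀ a b → χ (a ∨ b) ≤ χ a + χ b
χ-∨ true  b = s≤s z≤n
χ-∨ false b = ≤-refl

χ-cross : ∀ a b c d → (a ≡ true → c ≡ true → ⊥) → (b ≡ true → d ≡ true → ⊥) →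
          χ a * χ d + χ b * χ c ≤ χ (a ∨ b) * χ (c ∨ d)
χ-cross true  _     true  _     ¬ac _   = ⊥-elim (¬ac refl refl)
χ-cross _     true  _     true  _   ¬bd = ⊥-elim (¬bd refl refl)
χ-cross false false _     _     _  _  = z≤n
χ-cross true  false false false _  _  = z≤n
χ-cross true  false false true  _  _  = ≤-refl
χ-cross true  true  false false _  _  = z≤n
χ-cross false true  false false _  _  = z≤n
χ-cross false true  true  false _  _  = ≤-refl

0<m*n⇒0<n : ∀ m n → 0 < m * n → 0 < n
0<m*n⇒0<n m zero    0<m*0 = contradiction (subst (0 <_) (*-zeroʳ m) 0<m*0) (<-irrefl refl)
0<m*n⇒0<n m (suc n) _     = z<s

sum-const : ∀ n x → sum {n} (λ _ → x) ≡ n * x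
sum-const zero    x = refl
sum-const (suc n) x = cong (_+_ x) (sum-const n x)

sum-mono-≤ : ∀ {n} {f g : Fin n → ℕ} → (∀ i → f i ≤ g i) → sum f ≤ sum g
sum-mono-≤ {zero}  f≤g = z≤n
sum-mono-≤ {suc n} f≤g = +-mono-≤ (f≤g zero) (sum-mono-≤ (f≤g ∘ suc))

term≤sum : ∀ {n} (f : Fin n → ℕ) i → f i ≤ sum f
term≤sum f zero    = m≤m+n _ _
term≤sum f (suc i) = ≤-trans (term≤sum (f ∘ suc) i) (m≤n+m _ _)

∃-term>0 : ∀ {n} (f : Fin n → ℕ) → 0 < sum f → ∃ λ i → 0 < f i
∃-term>0 {suc n} f Σf>0 with f zero in f₀≡
... | suc _ = zero , subst (0 <_) (sym f₀≡) z<s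
... | zero  = Product.map suc id (∃-term>0 (f ∘ suc) Σf>0)

0<sum⇒0<n : ∀ {n} (f : Fin n → ℕ) → 0 < sum f → 0 < n
0<sum⇒0<n {suc n} _ _ = z<s

∃-term-≤ : ∀ {n} (f g : Fin n → ℕ) → sum f ≤ sum g → 0 < sum g →
           ∃ λ i → f i ≤ g i × 0 < g i
∃-term-≤ {suc n} f g Σf≤Σg Σg>0 with f zero ≤? g zero | 0 <? g zero
... | yes f₀≤g₀ | yes g₀>0 = zero , f₀≤g₀ , g₀>0
... | yes _     | no g₀≯0  = Product.map suc id
  (∃-term-≤ (f ∘ suc) (g ∘ suc) (≤-trans (m≤n+m _ (f zero)) (≤-trans Σf≤Σg drop-g₀))
                                (<-≤-trans Σg>0 drop-g₀))
  where
  drop-g₀ : sum g ≤ sum (g ∘ suc)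
  drop-g₀ = +-monoˡ-≤ (sum (g ∘ suc)) (≮⇒≥ g₀≯0)
... | no f₀≰g₀  | _        = Product.map suc id
  (∃-term-≤ (f ∘ suc) (g ∘ suc) (<⇒≤ tail<) (≤-<-trans z≤n tail<))
  where
  tail< : sum (f ∘ suc) < sum (g ∘ suc)
  tail< = +-cancelˡ-< (g zero) _ _ (<-≤-trans (+-monoˡ-< (sum (f ∘ suc)) (≰⇒> f₀≰g₀)) Σf≤Σg)

sum-pairs : ∀ {K} (s : Fin K → ℕ) → sum (λ i → sum (λ j → s i + s j)) ≡ 2 * K * sum s
sum-pairs {K} s = begin
  sum (λ i → sum (λ j → s i + s j))
    ≡⟨ sum-cong-≗ (λ i → trans (∑-distrib-+ (λ _ → s i) s) (cong (_+ sum s) (sum-const K (s i)))) ⟩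
  sum (λ i → K * s i + sum s)
    ≡⟨ ∑-distrib-+ (λ i → K * s i) (λ _ → sum s) ⟩
  sum (λ i → K * s i) + sum {K} (λ _ → sum s)
    ≡⟨ cong₂ _+_ (sym (*-distribˡ-sum K s)) (sum-const K (sum s)) ⟩
  K * sum s + K * sum s
    ≡⟨ double K (sum s) ⟩
  2 * K * sum s ∎
  where
  open ≡-Reasoning
  double : ∀ x y → x * y + x * y ≡ 2 * x * y
  double = solve-∀

*-distribˡ-sum² : ∀ {m n} c (F : Fin m → Fin n → ℕ) →
                  c * sum (λ i → sum (F i)) ≡ sum (λ i → sum (λ j → c * F i j))
*-distribˡ-sum² c F = trans (*-distribˡ-sum c (sum ∘ F)) (sum-cong-≗ (λ i → *-distribˡ-sum c (F i)))

∃-pair-≤ : ∀ {m n} (f g : Fin m → Fin n → ℕ) →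
           sum (λ i → sum (f i)) ≤ sum (λ i → sum (g i)) → 0 < sum (λ i → sum (g i)) →
           ∃₂ λ i j → f i j ≤ g i j × 0 < g i j
∃-pair-≤ f g ΣΣf≤ΣΣg ΣΣg>0 with ∃-term-≤ (sum ∘ f) (sum ∘ g) ΣΣf≤ΣΣg ΣΣg>0
... | i , Σfᵢ≤Σgᵢ , Σgᵢ>0 = i , ∃-term-≤ (f i) (g i) Σfᵢ≤Σgᵢ Σgᵢ>0

δ : ∀ {n} → Fin n → Fin n → ℕ
δ u w = χ (does (w Finₚ.≟ u))

sum-δ : ∀ {n} (u : Fin n) (g : Fin n → ℕ) → sum (λ w → δ u w * g w) ≡ g u
sum-δ {suc n} zero    g = trans (cong₂ _+_ (+-identityʳ (g zero)) (sum-replicate-zero n)) (+-identityʳ (g zero))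
sum-δ {suc n} (suc u) g = sum-δ u (g ∘ suc)

sum-↑ : ∀ m n (f : Fin (m + n) → ℕ) → sum f ≡ sum (λ i → f (i ↑ˡ n)) + sum (λ j → f (m ↑ʳ j))
sum-↑ zero    n f = refl
sum-↑ (suc m) n f = trans (cong (_+_ (f zero)) (sum-↑ m n (f ∘ suc))) (sym (+-assoc (f zero) _ _))

sum-combine : ∀ m n (f : Fin (m * n) → ℕ) → sum f ≡ sum (λ i → sum (λ j → f (combine {m} {n} i j)))
sum-combine zero    n f = refl
sum-combine (suc m) n f =
  trans (sum-↑ n (m * n) f) (cong (_+_ (sum (λ j → f (j ↑ˡ (m * n))))) (sum-combine m n (λ x → f (n ↑ʳ x))))

count≡sum : ∀ {k} (p : Fin k → Bool) → count p ≡ sum (χ ∘ p)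
count≡sum {zero}  p = refl
count≡sum {suc k} p with p zero
... | true  = cong suc (count≡sum (p ∘ suc))
... | false = count≡sum (p ∘ suc)

-- Vertex sets, degrees and edge counts

dense-step : ∀ a b s D t → 2 * a * suc s ≤ b * (D + 2 * t) → t * b < a → 2 * a * s < b * D
dense-step a b s D t dense low = +-cancelʳ-< (2 * a) (2 * a * s) (b * D) (begin-strict
  2 * a * s + 2 * a     ≡⟨ *-suc-comm (2 * a) s ⟩
  2 * a * suc s         ≤⟨ dense ⟩
  b * (D + 2 * t)       ≡⟨ expand b D t ⟩
  b * D + 2 * (t * b)   <⟨ +-monoʳ-< (b * D) (*-monoʳ-< 2 low) ⟩
  b * D + 2 * a         ∎)
  where
  open ≤-Reasoning
  *-suc-comm : ∀ x y → x * y + x ≡ x * suc y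
  *-suc-comm = solve-∀
  expand : ∀ x y z → x * (y + 2 * z) ≡ x * y + 2 * (z * x)
  expand = solve-∀

_⊆_ : ∀ {n} → VSet n → VSet n → Set
T ⊆ S = ∀ v → T v ≡ true → S v ≡ true

_∪_ : ∀ {n} → VSet n → VSet n → VSet n
(X ∪ Y) w = X w ∨ Y w

Nonempty : ∀ {n} → VSet n → Set
Nonempty S = ∃ λ v → S v ≡ true

module Counting {n : ℕ} (G : Graph n) where

  MinDegreeAtLeast : ℕ → ℕ → VSet n → Set
  MinDegreeAtLeast a b T = ∀ v → T v ≡ true → a ≤ degreeIn G T v * b

  A : Fin n → Fin n → ℕ
  A x y = χ (adj G x y)

  A-sym : ∀ x y → A x y ≡ A y x
  A-sym x y = cong χ (Graph.sym G x y)

  A-irrefl : ∀ x → A x x ≡ 0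
  A-irrefl x = cong χ (irrefl G x)

  size : VSet n → ℕ
  size S = sum (χ ∘ S)

  deg : VSet n → Fin n → ℕ
  deg S v = sum (λ x → A v x * χ (S x))

  form : (Fin n → ℕ) → (Fin n → ℕ) → ℕ
  form f g = sum (λ x → f x * sum (λ y → A x y * g y))

  edges : VSet n → VSet n → ℕ
  edges X Y = form (χ ∘ X) (χ ∘ Y)

  degreeSum : VSet n → ℕ
  degreeSum S = edges S S

  degree≡sum : ∀ v → degree G v ≡ sum (A v)
  degree≡sum v = count≡sum (adj G v)

  degreeIn≡deg : ∀ S v → degreeIn G S v ≡ deg S v
  degreeIn≡deg S v = trans (count≡sum (λ x → adj G v x ∧ S x)) (sum-cong-≗ (λ x → χ-∧ (adj G v x) (S x)))

  form-expand : ∀ f g → form f g ≡ sum (λ x → sum (λ y → f x * (A x y * g y)))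
  form-expand f g = sum-cong-≗ (λ x → *-distribˡ-sum (f x) (λ y → A x y * g y))

  form-sym : ∀ f g → form f g ≡ form g f
  form-sym f g = begin
    form f g                                          ≡⟨ form-expand f g ⟩
    sum (λ x → sum (λ y → f x * (A x y * g y)))        ≡⟨ ∑-comm (λ x y → f x * (A x y * g y)) ⟩
    sum (λ y → sum (λ x → f x * (A x y * g y)))        ≡⟨ sum-cong-≗ (λ y → sum-cong-≗ (λ x → swap x y)) ⟩
    sum (λ y → sum (λ x → g y * (A y x * f x)))        ≡⟨ form-expand g f ⟨
    form g f                                          ∎
    where
    open ≡-Reasoning
    swap : ∀ x y → f x * (A x y * g y) ≡ g y * (A y x * f x)
    swap x y rewrite A-sym x y = x∙yz≈z∙yx (f x) (A y x) (g y)

  form-sumˡ : ∀ {K} (F : Fin K → Fin n → ℕ) g → sum (λ i → form (F i) g) ≡ form (λ x → sum (λ i → F i x)) g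
  form-sumˡ F g = trans (∑-comm (λ i x → F i x * row x))
                        (sum-cong-≗ (λ x → sym (*-distribʳ-sum (row x) (λ i → F i x))))
    where
    row : Fin n → ℕ
    row x = sum (λ y → A x y * g y)

  form-sumʳ : ∀ {K} f (F : Fin K → Fin n → ℕ) → sum (λ j → form f (F j)) ≡ form f (λ y → sum (λ j → F j y))
  form-sumʳ f F = begin
    sum (λ j → form f (F j))               ≡⟨ sum-cong-≗ (λ j → form-sym f (F j)) ⟩
    sum (λ j → form (F j) f)               ≡⟨ form-sumˡ F f ⟩
    form (λ y → sum (λ j → F j y)) f       ≡⟨ form-sym _ f ⟩
    form f (λ y → sum (λ j → F j y))       ∎
    where open ≡-Reasoning

  size-∪ : ∀ X Y → size (X ∪ Y) ≤ size X + size Y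
  size-∪ X Y = ≤-trans (sum-mono-≤ (λ w → χ-∨ (X w) (Y w))) (≤-reflexive (∑-distrib-+ (χ ∘ X) (χ ∘ Y)))

  edges-∪ : ∀ {X Y} → Independent G X → Independent G Y → edges X Y + edges Y X ≤ degreeSum (X ∪ Y)
  edges-∪ {X} {Y} X-indep Y-indep = begin
    edges X Y + edges Y X
      ≡⟨ cong₂ _+_ (form-expand (χ ∘ X) (χ ∘ Y)) (form-expand (χ ∘ Y) (χ ∘ X)) ⟩
    sum (λ x → sum (XY x)) + sum (λ x → sum (YX x))
      ≡⟨ ∑-distrib-+ (sum ∘ XY) (sum ∘ YX) ⟨
    sum (λ x → sum (XY x) + sum (YX x))
      ≡⟨ sum-cong-≗ (λ x → ∑-distrib-+ (XY x) (YX x)) ⟨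
    sum (λ x → sum (λ y → XY x y + YX x y))
      ≤⟨ sum-mono-≤ (λ x → sum-mono-≤ (λ y → cross x y)) ⟩
    sum (λ x → sum (λ y → χ ((X ∪ Y) x) * (A x y * χ ((X ∪ Y) y))))
      ≡⟨ form-expand (χ ∘ (X ∪ Y)) (χ ∘ (X ∪ Y)) ⟨
    degreeSum (X ∪ Y) ∎
    where
    open ≤-Reasoning
    XY YX : Fin n → Fin n → ℕ
    XY x y = χ (X x) * (A x y * χ (Y y))
    YX x y = χ (Y x) * (A x y * χ (X y))
    cross : ∀ x y → XY x y + YX x y ≤ χ ((X ∪ Y) x) * (A x y * χ ((X ∪ Y) y))
    cross x y with adj G x y in xy
    ... | false = subst (_≤ χ ((X ∪ Y) x) * 0) (sym (cong₂ _+_ (*-zeroʳ (χ (X x))) (*-zeroʳ (χ (Y x))))) z≤n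
    ... | true  = begin
      χ (X x) * (1 * χ (Y y)) + χ (Y x) * (1 * χ (X y))
        ≡⟨ cong₂ _+_ (cong (χ (X x) *_) (*-identityˡ _)) (cong (χ (Y x) *_) (*-identityˡ _)) ⟩
      χ (X x) * χ (Y y) + χ (Y x) * χ (X y)
        ≤⟨ χ-cross (X x) (Y x) (X y) (Y y) (both X-indep) (both Y-indep) ⟩
      χ ((X ∪ Y) x) * χ ((X ∪ Y) y)
        ≡⟨ cong (χ ((X ∪ Y) x) *_) (*-identityˡ _) ⟨
      χ ((X ∪ Y) x) * (1 * χ ((X ∪ Y) y)) ∎
      where
      both : ∀ {Z} → Independent G Z → Z x ≡ true → Z y ≡ true → ⊥
      both Z-indep x∈Z y∈Z = contradiction (trans (sym xy) (Z-indep x y x∈Z y∈Z)) λ ()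

  column≡deg : ∀ T u → sum (λ w → χ (T w) * A w u) ≡ deg T u
  column≡deg T u = sum-cong-≗ (λ w → trans (*-comm (χ (T w)) (A w u)) (cong (_* χ (T w)) (A-sym w u)))

  nonempty⇒size>0 : ∀ {S v} → S v ≡ true → 0 < size S
  nonempty⇒size>0 {S} {v} v∈S = <-≤-trans (subst (λ b → 0 < χ b) (sym v∈S) z<s) (term≤sum (χ ∘ S) v)

  degreeSum>0⇒nonempty : ∀ S → 0 < degreeSum S → Nonempty S
  degreeSum>0⇒nonempty S D>0 with ∃-term>0 (λ w → χ (S w) * deg S w) D>0
  ... | w , term>0 with S w in w∈S
  ...   | true  = w , w∈S
  ...   | false = contradiction term>0 (<-irrefl refl)

  delete : Fin n → VSet n → VSet n
  delete u S w = S w ∧ not (does (w Finₚ.≟ u))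

  module _ {S : VSet n} {u : Fin n} (u∈S : S u ≡ true) where

    χ-delete : ∀ w → χ (S w) ≡ χ (delete u S w) + δ u w
    χ-delete w with w Finₚ.≟ u
    ... | yes refl rewrite u∈S = refl
    ... | no _     = trans (cong χ (sym (Boolₚ.∧-identityʳ (S w)))) (sym (+-identityʳ _))

    size-delete : size S ≡ suc (size (delete u S))
    size-delete = begin
      size S
        ≡⟨ sum-cong-≗ χ-delete ⟩
      sum (λ w → χ (delete u S w) + δ u w)
        ≡⟨ ∑-distrib-+ (χ ∘ delete u S) (λ w → δ u w) ⟩
      size (delete u S) + sum (λ w → δ u w)
        ≡⟨ cong (_+_ (size (delete u S))) (trans (sum-cong-≗ (λ w → sym (*-identityʳ (δ u w))))
                                                 (sum-δ u (λ _ → 1))) ⟩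
      size (delete u S) + 1
        ≡⟨ +-comm _ 1 ⟩
      suc (size (delete u S)) ∎
      where open ≡-Reasoning

    deg-delete : ∀ w → deg S w ≡ deg (delete u S) w + A w u
    deg-delete w = begin
      deg S w
        ≡⟨ sum-cong-≗ (λ x → trans (cong (A w x *_) (χ-delete x)) (*-distribˡ-+ (A w x) _ _)) ⟩
      sum (λ x → A w x * χ (delete u S x) + A w x * δ u x)
        ≡⟨ ∑-distrib-+ (λ x → A w x * χ (delete u S x)) (λ x → A w x * δ u x) ⟩
      deg (delete u S) w + sum (λ x → A w x * δ u x)
        ≡⟨ cong (_+_ (deg (delete u S) w)) (trans (sum-cong-≗ (λ x → *-comm (A w x) (δ u x)))
                                                   (sum-δ u (A w))) ⟩
      deg (delete u S) w + A w u ∎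
      where open ≡-Reasoning

    deg-delete-self : deg S u ≡ deg (delete u S) u
    deg-delete-self = trans (deg-delete u) (trans (cong (_+_ (deg (delete u S) u)) (A-irrefl u)) (+-identityʳ _))

    degreeSum-delete : degreeSum S ≡ degreeSum (delete u S) + 2 * deg (delete u S) u
    degreeSum-delete = begin
      sum (λ w → χ (S w) * deg S w)
        ≡⟨ sum-cong-≗ (λ w → trans (cong (_* deg S w) (χ-delete w))
                                   (*-distribʳ-+ (deg S w) (χ (S' w)) (δ u w))) ⟩
      sum (λ w → χ (S' w) * deg S w + δ u w * deg S w)
        ≡⟨ ∑-distrib-+ (λ w → χ (S' w) * deg S w) (λ w → δ u w * deg S w) ⟩
      sum (λ w → χ (S' w) * deg S w) + sum (λ w → δ u w * deg S w)
        ≡⟨ cong₂ _+_ (sum-cong-≗ (λ w → trans (cong (χ (S' w) *_) (deg-delete w)) (*-distribˡ-+ (χ (S' w)) _ _)))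
                     (sum-δ u (deg S)) ⟩
      sum (λ w → χ (S' w) * deg S' w + χ (S' w) * A w u) + deg S u
        ≡⟨ cong₂ _+_ (∑-distrib-+ (λ w → χ (S' w) * deg S' w) (λ w → χ (S' w) * A w u)) deg-delete-self ⟩
      degreeSum S' + sum (λ w → χ (S' w) * A w u) + deg S' u
        ≡⟨ cong (λ k → degreeSum S' + k + deg S' u) (column≡deg S' u) ⟩
      degreeSum S' + deg S' u + deg S' u
        ≡⟨ double (degreeSum S') (deg S' u) ⟩
      degreeSum S' + 2 * deg S' u ∎
      where
      open ≡-Reasoning
      S' : VSet n
      S' = delete u S
      double : ∀ x y → x + y + y ≡ x + 2 * y
      double = solve-∀

  denseCore : ∀ a b S → 2 * a * size S ≤ b * degreeSum S → 0 < degreeSum S →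
              Σ (VSet n) λ T → T ⊆ S × Nonempty T × MinDegreeAtLeast a b T
  denseCore a b S = shrink (size S) S refl
    where
    shrink : ∀ m S → size S ≡ m → 2 * a * size S ≤ b * degreeSum S → 0 < degreeSum S →
             Σ (VSet n) λ T → T ⊆ S × Nonempty T × MinDegreeAtLeast a b T
    shrink zero S |S|≡0 _ D>0 =
      contradiction (subst (0 <_) |S|≡0 (nonempty⇒size>0 (proj₂ (degreeSum>0⇒nonempty S D>0)))) (<-irrefl refl)
    shrink (suc m) S |S|≡1+m dense D>0 with any? (λ u → (S u Boolₚ.≟ true) ×-dec (deg S u * b <? a))
    ... | no no-low = S , (λ _ → id) , degreeSum>0⇒nonempty S D>0 , high
      where
      high : MinDegreeAtLeast a b S
      high v v∈S rewrite degreeIn≡deg S v = ≮⇒≥ (λ low → no-low (v , v∈S , low))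
    ... | yes (u , u∈S , low) =
      Product.map id (Product.map (λ T⊆S' v v∈T → Boolₚ.∧-conicalˡ (S v) _ (T⊆S' v v∈T)) id)
        (shrink m S' (suc-injective (trans (sym (size-delete u∈S)) |S|≡1+m))
                     (<⇒≤ dense') (0<m*n⇒0<n b _ (≤-<-trans z≤n dense')))
      where
      S' : VSet n
      S' = delete u S
      dense' : 2 * a * size S' < b * degreeSum S'
      dense' = dense-step a b (size S') (degreeSum S') (deg S' u)
        (subst₂ (λ s D → 2 * a * s ≤ b * D) (size-delete u∈S) (degreeSum-delete u∈S) dense)
        (subst (λ k → k * b < a) (deg-delete-self u∈S) low)

  union-bipartite : ∀ {X Y T} → Independent G X → Independent G Y → T ⊆ (X ∪ Y) → BipartiteInduced G T
  union-bipartite {X} {Y} {T} X-indep Y-indep T⊆X∪Y = X , proper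
    where
    proper : ∀ u w → T u ≡ true → T w ≡ true → adj G u w ≡ true → X u ≢ X w
    proper u w u∈T w∈T uw with X u in Xu | X w in Xw
    ... | true  | true  = λ _ → contradiction (trans (sym uw) (X-indep u w Xu Xw)) λ ()
    ... | true  | false = λ ()
    ... | false | true  = λ ()
    ... | false | false = λ _ → contradiction (trans (sym uw) (Y-indep u w (only-Y Xu (T⊆X∪Y u u∈T))
                                                                        (only-Y Xw (T⊆X∪Y w w∈T)))) λ ()
      where
      only-Y : ∀ {v} → X v ≡ false → (X ∪ Y) v ≡ true → Y v ≡ true
      only-Y Xv X∨Y rewrite Xv = X∨Y

  bipartiteCore : ∀ a b {X Y} → Independent G X → Independent G Y →
                  a * (size X + size Y) ≤ b * edges X Y → 0 < edges X Y →
                  Σ (VSet n) λ T → Nonempty T × BipartiteInduced G T × MinDegreeAtLeast a b T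
  bipartiteCore a b {X} {Y} X-indep Y-indep dense e>0 =
    let T , T⊆X∪Y , T-nonempty , T-minDeg = denseCore a b (X ∪ Y) dense∪ D>0
    in  T , T-nonempty , union-bipartite X-indep Y-indep T⊆X∪Y , T-minDeg
    where
    2e≤D : edges X Y + edges X Y ≤ degreeSum (X ∪ Y)
    2e≤D = subst (λ e′ → edges X Y + e′ ≤ degreeSum (X ∪ Y)) (form-sym (χ ∘ Y) (χ ∘ X))
                 (edges-∪ X-indep Y-indep)
    dense∪ : 2 * a * size (X ∪ Y) ≤ b * degreeSum (X ∪ Y)
    dense∪ = begin
      2 * a * size (X ∪ Y)          ≤⟨ *-monoʳ-≤ (2 * a) (size-∪ X Y) ⟩
      2 * a * (size X + size Y)     ≡⟨ *-assoc 2 a _ ⟩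
      2 * (a * (size X + size Y))   ≤⟨ *-monoʳ-≤ 2 dense ⟩
      2 * (b * edges X Y)           ≡⟨ twice b (edges X Y) ⟩
      b * (edges X Y + edges X Y)   ≤⟨ *-monoʳ-≤ b 2e≤D ⟩
      b * degreeSum (X ∪ Y)         ∎
      where
      open ≤-Reasoning
      twice : ∀ x y → 2 * (x * y) ≡ x * (y + y)
      twice = solve-∀
    D>0 : 0 < degreeSum (X ∪ Y)
    D>0 = <-≤-trans e>0 (≤-trans (m≤m+n _ _) 2e≤D)

-- A dense pair of independent sets

record DegreeCover {n : ℕ} (G : Graph n) (K : ℕ) : Set where
  field
    class       : Fin K → VSet n
    independent : ∀ i → Independent G (class i)
    covers      : ∀ v → degree G v ≤ count (λ i → class i v)

module _ {n K : ℕ} {G : Graph n} (cover : DegreeCover G K) where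

  open Counting G
  open DegreeCover cover

  multiplicity : Fin n → ℕ
  multiplicity v = sum (λ i → χ (class i v))

  module _ (d : ℕ) (minDeg : ∀ v → d ≤ degree G v) where

    multiplicity≥d : ∀ v → d ≤ multiplicity v
    multiplicity≥d v = ≤-trans (minDeg v) (subst (degree G v ≤_) (count≡sum (λ i → class i v)) (covers v))

    row : Fin n → ℕ
    row x = sum (λ y → A x y * multiplicity y)

    d²≤row : ∀ x → d * d ≤ row x
    d²≤row x = begin
      d * d                    ≤⟨ *-monoˡ-≤ d (minDeg x) ⟩
      degree G x * d           ≡⟨ cong (_* d) (degree≡sum x) ⟩
      sum (A x) * d            ≡⟨ *-distribʳ-sum d (A x) ⟩
      sum (λ y → A x y * d)    ≤⟨ sum-mono-≤ (λ y → *-monoʳ-≤ (A x y) (multiplicity≥d y)) ⟩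
      row x                    ∎
      where open ≤-Reasoning

    total : ℕ
    total = sum (λ i → size (class i))

    total≡sum-multiplicity : total ≡ sum multiplicity
    total≡sum-multiplicity = ∑-comm (λ i x → χ (class i x))

    d²total≤form : d * d * total ≤ form multiplicity multiplicity
    d²total≤form = begin
      d * d * total                        ≡⟨ cong (d * d *_) total≡sum-multiplicity ⟩
      d * d * sum multiplicity             ≡⟨ *-distribˡ-sum (d * d) multiplicity ⟩
      sum (λ x → d * d * multiplicity x)   ≤⟨ sum-mono-≤ (λ x → subst (_≤ multiplicity x * row x)
                                                 (*-comm (multiplicity x) (d * d))
                                                 (*-monoʳ-≤ (multiplicity x) (d²≤row x))) ⟩
      form multiplicity multiplicity       ∎
      where open ≤-Reasoning

    densePair : 0 < d → Fin n → ∃₂ λ i j →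
                d * d * (size (class i) + size (class j)) ≤ 2 * K * edges (class i) (class j)
                × 0 < edges (class i) (class j)
    densePair d>0 v =
      let i , j , dense , 2K·edges>0 = ∃-pair-≤ lhs rhs Σlhs≤Σrhs (<-≤-trans Σlhs>0 Σlhs≤Σrhs)
      in  i , j , dense , 0<m*n⇒0<n (2 * K) _ 2K·edges>0
      where
      open ≡-Reasoning
      lhs rhs : Fin K → Fin K → ℕ
      lhs i j = d * d * (size (class i) + size (class j))
      rhs i j = 2 * K * edges (class i) (class j)
      Σlhs : sum (λ i → sum (lhs i)) ≡ 2 * K * (d * d * total)
      Σlhs = begin
        sum (λ i → sum (λ j → d * d * (size (class i) + size (class j))))
          ≡⟨ *-distribˡ-sum² (d * d) (λ i j → size (class i) + size (class j)) ⟨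
        d * d * sum (λ i → sum (λ j → size (class i) + size (class j)))
          ≡⟨ cong (d * d *_) (sum-pairs (λ i → size (class i))) ⟩
        d * d * (2 * K * total)
          ≡⟨ x∙yz≈y∙xz (d * d) (2 * K) total ⟩
        2 * K * (d * d * total) ∎
      Σrhs : sum (λ i → sum (rhs i)) ≡ 2 * K * form multiplicity multiplicity
      Σrhs = begin
        sum (λ i → sum (λ j → 2 * K * edges (class i) (class j)))
          ≡⟨ *-distribˡ-sum² (2 * K) (λ i j → edges (class i) (class j)) ⟨
        2 * K * sum (λ i → sum (λ j → edges (class i) (class j)))
          ≡⟨ cong (2 * K *_) (sum-cong-≗ (λ i → form-sumʳ (χ ∘ class i) (λ j → χ ∘ class j))) ⟩
        2 * K * sum (λ i → form (χ ∘ class i) multiplicity)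
          ≡⟨ cong (2 * K *_) (form-sumˡ (λ i → χ ∘ class i) multiplicity) ⟩
        2 * K * form multiplicity multiplicity ∎
      Σlhs≤Σrhs : sum (λ i → sum (lhs i)) ≤ sum (λ i → sum (rhs i))
      Σlhs≤Σrhs = subst₂ _≤_ (sym Σlhs) (sym Σrhs) (*-monoʳ-≤ (2 * K) d²total≤form)
      Σlhs>0 : 0 < sum (λ i → sum (lhs i))
      Σlhs>0 = subst (0 <_) (sym Σlhs)
                 (*-mono-≤ (≤-trans K>0 (m≤m+n K _)) (*-mono-≤ (*-mono-≤ d>0 d>0) total>0))
        where
        K>0 : 0 < K
        K>0 = 0<sum⇒0<n (λ i → χ (class i v)) (<-≤-trans d>0 (multiplicity≥d v))
        total>0 : 0 < total
        total>0 = subst (0 <_) (sym total≡sum-multiplicity)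
                    (<-≤-trans d>0 (≤-trans (multiplicity≥d v) (term≤sum multiplicity v)))

-- Layers of a neighbourhood

does⇒witness : ∀ {a} {A : Set a} (a? : Dec A) → does a? ≡ true → A
does⇒witness (yes a) _ = a

firstFailure : ∀ {p} {P : ℕ → Set p} → Decidable P → P 0 → ∀ k → ¬ P k →
               ∃ λ j → j < k × P j × ¬ P (suc j)
firstFailure P? P₀ zero    ¬P₀ = contradiction P₀ ¬P₀
firstFailure P? P₀ (suc k) ¬Pₖ₊₁ with P? k
... | yes Pₖ = k , ≤-refl , Pₖ , ¬Pₖ₊₁
... | no ¬Pₖ = Product.map id (Product.map m<n⇒m<1+n id) (firstFailure P? P₀ k ¬Pₖ)

module NeighbourhoodChains {n : ℕ} (G : Graph n) (v : Fin n) where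

  Chain : ℕ → Fin n → Set
  Chain zero    u = adj G v u ≡ true
  Chain (suc t) u = adj G v u ≡ true × ∃ λ w → toℕ w < toℕ u × adj G w u ≡ true × Chain t w

  chain? : ∀ t u → Dec (Chain t u)
  chain? zero    u = adj G v u Boolₚ.≟ true
  chain? (suc t) u = (adj G v u Boolₚ.≟ true)
    ×-dec any? (λ w → (toℕ w <? toℕ u) ×-dec (adj G w u Boolₚ.≟ true) ×-dec chain? t w)

  chain⇒adj : ∀ {t u} → Chain t u → adj G v u ≡ true
  chain⇒adj {zero}  vu       = vu
  chain⇒adj {suc t} (vu , _) = vu

  InLayer : ℕ → Fin n → Set
  InLayer t u = Chain t u × ¬ Chain (suc t) u

  inLayer? : ∀ t u → Dec (InLayer t u)
  inLayer? t u = chain? t u ×-dec ¬? (chain? (suc t) u)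

  layer : ℕ → VSet n
  layer t u = does (inLayer? t u)

  layer⇒InLayer : ∀ {t u} → layer t u ≡ true → InLayer t u
  layer⇒InLayer {t} {u} = does⇒witness (inLayer? t u)

  lower-neighbour : ∀ {t u w} → layer t u ≡ true → layer t w ≡ true → toℕ w < toℕ u → adj G w u ≡ false
  lower-neighbour {t} {u} {w} u∈ w∈ w<u with adj G w u in wu
  ... | false = refl
  ... | true  =
    let u-chain , u-top = layer⇒InLayer u∈
        w-chain , _     = layer⇒InLayer w∈
    in  contradiction (chain⇒adj u-chain , w , w<u , wu , w-chain) u-top

  layer-independent : ∀ t → Independent G (layer t)
  layer-independent t u w u∈ w∈ with Finₚ.<-cmp u w
  ... | tri< u<w _ _ = lower-neighbour w∈ u∈ u<w
  ... | tri≈ _ refl _ = irrefl G u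
  ... | tri> _ _ w<u = trans (Graph.sym G u w) (lower-neighbour u∈ w∈ w<u)

  layer-cover : ∀ k u → adj G v u ≡ true → ¬ Chain k u → ∃ λ (j : Fin k) → layer (toℕ j) u ≡ true
  layer-cover k u vu no-chain =
    let j , j<k , j-chain , no-longer = firstFailure (λ t → chain? t u) vu k no-chain
    in  fromℕ< j<k , subst (λ t → layer t u ≡ true) (sym (Finₚ.toℕ-fromℕ< j<k))
                       (dec-true (inLayer? j u) (j-chain , no-longer))

  vertex : ∀ {t u} → Chain t u → Fin (suc t) → Fin n
  vertex {u = u} _                 zero    = u
  vertex {suc t} (_ , _ , _ , _ , c) (suc i) = vertex c i

  vertex-adj : ∀ {t u} (c : Chain t u) i → adj G v (vertex c i) ≡ true
  vertex-adj c                          zero    = chain⇒adj c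
  vertex-adj {suc t} (_ , _ , _ , _ , c) (suc i) = vertex-adj c i

  vertex≤end : ∀ {t u} (c : Chain t u) i → toℕ (vertex c i) ≤ toℕ u
  vertex≤end c                            zero    = ≤-refl
  vertex≤end {suc t} (_ , _ , w<u , _ , c) (suc i) = <⇒≤ (≤-<-trans (vertex≤end c i) w<u)

  vertex-decreasing : ∀ {t u} (c : Chain t u) {i j} → toℕ i < toℕ j → toℕ (vertex c j) < toℕ (vertex c i)
  vertex-decreasing {suc t} (_ , _ , w<u , _ , c) {zero}  {suc j} _   = ≤-<-trans (vertex≤end c j) w<u
  vertex-decreasing {suc t} (_ , _ , _ , _ , c)   {suc i} {suc j} i<j = vertex-decreasing c (s<s⁻¹ i<j)

  vertex-injective : ∀ {t u} (c : Chain t u) {i j} → vertex c i ≡ vertex c j → i ≡ j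
  vertex-injective c {i} {j} eq with Finₚ.<-cmp i j
  ... | tri< i<j _ _ = contradiction (cong toℕ (sym eq)) (<⇒≢ (vertex-decreasing c i<j))
  ... | tri≈ _ i≡j _ = i≡j
  ... | tri> _ _ j<i = contradiction (cong toℕ eq) (<⇒≢ (vertex-decreasing c j<i))

  vertex-step : ∀ {t u} (c : Chain t u) i j → toℕ j ≡ suc (toℕ i) → adj G (vertex c i) (vertex c j) ≡ true
  vertex-step {suc t} {u} (_ , w , _ , wu , _) zero    (suc zero) _  = trans (Graph.sym G u w) wu
  vertex-step {suc t}     (_ , _ , _ , _ , c)  (suc i) (suc j)    eq = vertex-step c i j (suc-injective eq)

  cycle : ∀ {t u} → Chain t u → Fin (2 + t) → Fin n
  cycle c zero    = v
  cycle c (suc i) = vertex c i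

  chain⇒cycle : ∀ {t u} → Chain t u → ContainsCycle (2 + t) G
  chain⇒cycle {t} c = cycle c , injective , edge
    where
    v≢vertex : ∀ i → v ≢ vertex c i
    v≢vertex i v≡ =
      contradiction (trans (sym (irrefl G v)) (subst (λ x → adj G v x ≡ true) (sym v≡) (vertex-adj c i))) λ ()
    injective : ∀ {i j} → cycle c i ≡ cycle c j → i ≡ j
    injective {zero}  {zero}  _  = refl
    injective {zero}  {suc j} eq = ⊥-elim (v≢vertex j eq)
    injective {suc i} {zero}  eq = ⊥-elim (v≢vertex i (sym eq))
    injective {suc i} {suc j} eq = cong suc (vertex-injective c eq)
    edge : ∀ i j → CycleNext i j → adj G (cycle c i) (cycle c j) ≡ true
    edge zero    (suc zero) (inj₁ _)  = vertex-adj c zero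
    edge (suc i) (suc j)    (inj₁ eq) = vertex-step c i j (suc-injective eq)
    edge (suc i) zero       _         = trans (Graph.sym G (vertex c i) v) (vertex-adj c i)

neighbourhoodCover : ∀ {n} (G : Graph n) k → ¬ ContainsCycle (2 + k) G → DegreeCover G (k * n)
neighbourhoodCover {n} G k C-free = record { class = class ; independent = independent ; covers = covers }
  where
  open Counting G using (A; A-sym; degree≡sum)
  open NeighbourhoodChains G

  class : Fin (k * n) → VSet n
  class i = let j , v = remQuot n i in layer v (toℕ j)

  independent : ∀ i → Independent G (class i)
  independent i = let j , v = remQuot n i in layer-independent v (toℕ j)

  class-combine : ∀ j v → class (combine j v) ≡ layer v (toℕ j)
  class-combine j v =
    cong (λ (jv : Fin k × Fin n) → layer (proj₂ jv) (toℕ (proj₁ jv))) (Finₚ.remQuot-combine j v)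

  edge≤layers : ∀ u v → A v u ≤ sum (λ (j : Fin k) → χ (layer v (toℕ j) u))
  edge≤layers u v = bound (adj G v u) refl
    where
    bound : ∀ b → adj G v u ≡ b → χ b ≤ sum (λ (j : Fin k) → χ (layer v (toℕ j) u))
    bound false _  = z≤n
    bound true  vu =
      let j , j-layer = layer-cover v k u vu (C-free ∘ chain⇒cycle v)
      in  ≤-trans (≤-reflexive (cong χ (sym j-layer))) (term≤sum (λ j → χ (layer v (toℕ j) u)) j)

  covers : ∀ u → degree G u ≤ count (λ i → class i u)
  covers u = begin
    degree G u
      ≡⟨ degree≡sum u ⟩
    sum (A u)
      ≡⟨ sum-cong-≗ (A-sym u) ⟩
    sum (λ v → A v u)
      ≤⟨ sum-mono-≤ (edge≤layers u) ⟩
    sum (λ v → sum (λ (j : Fin k) → χ (layer v (toℕ j) u)))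
      ≡⟨ ∑-comm (λ v (j : Fin k) → χ (layer v (toℕ j) u)) ⟩
    sum (λ (j : Fin k) → sum (λ v → χ (layer v (toℕ j) u)))
      ≡⟨ sum-cong-≗ (λ j → sum-cong-≗ (λ v → cong (λ S → χ (S u)) (sym (class-combine j v)))) ⟩
    sum (λ (j : Fin k) → sum (λ v → χ (class (combine j v) u)))
      ≡⟨ sum-combine k n (λ i → χ (class i u)) ⟨
    sum (λ i → χ (class i u))
      ≡⟨ count≡sum (λ i → class i u) ⟨
    count (λ i → class i u) ∎
    where open ≤-Reasoning

-- Fractional colouring by unit weights

module UnitFraction (d-1 : ℕ) where

  1/d : ℚ
  1/d = + 1 / suc d-1

  +-unitFractionᵘ : ∀ c → mkℚᵘ (+ 1) d-1 ℚᵘ.+ mkℚᵘ (+ c) d-1 ≃ mkℚᵘ (+ suc c) d-1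
  +-unitFractionᵘ c = *≡* (begin
    (+ 1 ℤ.* D ℤ.+ + c ℤ.* D) ℤ.* D     ≡⟨ distrib (+ c) D ⟩
    (+ 1 ℤ.+ + c) ℤ.* (D ℤ.* D)         ≡⟨ cong (+ suc c ℤ.*_) (ℤₚ.pos-* (suc d-1) (suc d-1)) ⟨
    + suc c ℤ.* + (suc d-1 * suc d-1)   ∎)
    where
    open ≡-Reasoning
    D : ℤ.ℤ
    D = + suc d-1
    distrib : ∀ x y → (+ 1 ℤ.* y ℤ.+ x ℤ.* y) ℤ.* y ≡ (+ 1 ℤ.+ x) ℤ.* (y ℤ.* y)
    distrib = ℤ-Solver.solve-∀

  toℚᵘ-/ : ∀ c → toℚᵘ (+ c / suc d-1) ≃ mkℚᵘ (+ c) d-1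
  toℚᵘ-/ c = ℚₚ.toℚᵘ-fromℚᵘ (mkℚᵘ (+ c) d-1)

  +-unitFraction : ∀ q c → toℚᵘ q ≃ mkℚᵘ (+ c) d-1 → toℚᵘ (1/d ℚ.+ q) ≃ mkℚᵘ (+ suc c) d-1
  +-unitFraction q c q≃c/d = ℚᵘₚ.≃-trans (ℚₚ.toℚᵘ-homo-+ 1/d q)
    (ℚᵘₚ.≃-trans (ℚᵘₚ.+-cong (toℚᵘ-/ 1) q≃c/d) (+-unitFractionᵘ c))

  toℚᵘ-≃⇒≡ : ∀ q c → toℚᵘ q ≃ mkℚᵘ (+ c) d-1 → q ≡ + c / suc d-1
  toℚᵘ-≃⇒≡ q c q≃c/d = trans (sym (ℚₚ.fromℚᵘ-toℚᵘ q)) (ℚₚ.fromℚᵘ-cong q≃c/d)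

  ∑-1/d : ∀ K → ∑ {K} (λ _ → 1/d) ≡ + K / suc d-1
  ∑-1/d K = toℚᵘ-≃⇒≡ _ K (∑≃ K)
    where
    ∑≃ : ∀ K → toℚᵘ (∑ {K} (λ _ → 1/d)) ≃ mkℚᵘ (+ K) d-1
    ∑≃ zero    = *≡* refl
    ∑≃ (suc K) = +-unitFraction _ K (∑≃ K)

  ∑[]-1/d : ∀ {K} (b : Fin K → Bool) → ∑[ b ] (λ _ → 1/d) ≡ + count b / suc d-1
  ∑[]-1/d b = toℚᵘ-≃⇒≡ _ (count b) (∑[]≃ b)
    where
    ∑[]≃ : ∀ {K} (b : Fin K → Bool) → toℚᵘ (∑[ b ] (λ _ → 1/d)) ≃ mkℚᵘ (+ count b) d-1
    ∑[]≃ {zero}  b = *≡* refl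
    ∑[]≃ {suc K} b with b zero
    ... | true  = +-unitFraction _ _ (∑[]≃ (b ∘ suc))
    ... | false = ∑[]≃ (b ∘ suc)

  1≤c/d : ∀ c → suc d-1 ≤ c → 1ℚ ℚ.≤ + c / suc d-1
  1≤c/d c d≤c = ℚₚ.toℚᵘ-cancel-≤ (ℚᵘₚ.≤-respʳ-≃ (ℚᵘₚ.≃-sym (toℚᵘ-/ c))
    (*≤* (subst₂ ℤ._≤_ (sym (ℤₚ.*-identityˡ (+ suc d-1))) (sym (ℤₚ.*-identityʳ (+ c))) (ℤ.+≤+ d≤c))))

  0≤1/d : 0ℚ ℚ.≤ 1/d
  0≤1/d = ℚₚ.toℚᵘ-cancel-≤ (ℚᵘₚ.≤-respʳ-≃ (ℚᵘₚ.≃-sym (toℚᵘ-/ 1)) (*≤* (ℤ.+≤+ z≤n)))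

fractionalColouring : ∀ {n K} {G : Graph n} d-1 → (∀ v → suc d-1 ≤ degree G v) → DegreeCover G K →
                      FracChromaticAtMost G (+ K / suc d-1)
fractionalColouring {K = K} {G} d-1 minDeg cover = colouring , ℚₚ.≤-reflexive (∑-1/d K)
  where
  open UnitFraction d-1
  open DegreeCover cover
  colouring : FractionalColouring G
  colouring = record
    { k      = K
    ; sets   = class
    ; weight = λ _ → 1/d
    ; indep  = independent
    ; nonneg = λ _ → 0≤1/d
    ; covers = λ v → subst (1ℚ ℚ.≤_) (sym (∑[]-1/d (λ i → class i v)))
                       (1≤c/d (count (λ i → class i v)) (≤-trans (minDeg v) (covers v)))
    }

corollary7p4 : (r : ℕ) → 3 ≤ r → (n : ℕ) → (G : Graph n) → (d : ℕ) → .{{_ : NonZero d}} →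
    ¬ ContainsCycle r G → MinDegree G d →
    FracChromaticAtMost G ((+ ((r ∸ 2) * n)) / d)
    × (Σ (VSet n) λ S → (∃ λ v → S v ≡ true) × BipartiteInduced G S
        × (∀ v → S v ≡ true → d * d ≤ degreeIn G S v * (2 * ((r ∸ 2) * n))))
corollary7p4 (suc (suc zero)) (s≤s (s≤s ()))
corollary7p4 (suc (suc (suc k))) _ n G zero {{()}}
corollary7p4 (suc (suc (suc k))) _ n G (suc d-1) C-free (minDeg , v , _) =
  let i , j , dense , edges>0 = densePair cover (suc d-1) minDeg z<s v
  in  fractionalColouring d-1 minDeg cover
    , Counting.bipartiteCore G (suc d-1 * suc d-1) (2 * (suc k * n)) (independent i) (independent j) dense edges>0
  where
  cover : DegreeCover G (suc k * n)
  cover = neighbourhoodCover G (suc k) C-free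
  open DegreeCover cover
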